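{- Let $n$, $k$, $s$ be nonnegative integers with $k,s\leq\left\lfloor\frac{n-1}{2}\right\rfloor$, and let $s_0=\min\{s,k\}$. Then $$\sum_{j=0}^{s_0}\binom{s+k-2j}{s-j}\binom{n-1-s-k+2j}{n-1-s-k+j}=\sum_{l=0}^{s_0}\binom{n}{l}.$$ -}

module Defs where

open import Data.Nat using (ℕ; zero; suc; _+_)

sumTo : ℕ → (ℕ → ℕ) → ℕ
sumTo zero    f = f zero
sumTo (suc m) f = sumTo m f + f (suc m)

{-# OPTIONS --safe #-}
module Submission where

-- With paths a b = C(a + b, a) and central p j = C(2j + p, j), the j-th summand is
-- paths (s - j) (k - j) · central q j for q = n - 1 - s - k, so for t = s ⊓ k and d = |s - k|
-- the left side is the convolution Σ_{j ≤ t} central d (t - j) · central q j.  That this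
-- equals Σ_{l ≤ t} C(q + 2t + d + 1, l) follows by induction on t and then q: Pascal's rule
-- central (q + 1) (j + 1) = central (q + 2) j + central q (j + 1), and
-- central 0 (j + 1) = 2 · central 1 j, split the convolution into two smaller ones, mirroring
-- Σ_{l ≤ t + 1} C(N + 1, l) = Σ_{l ≤ t + 1} C(N, l) + Σ_{l ≤ t} C(N, l).

open import Defs
open import Data.Nat using (ℕ; zero; suc; _+_; _*_; _∸_; _≤_; _⊓_; z≤n)
open import Data.Nat.Combinatorics using (_C_; nCk+nC[k+1]≡[n+1]C[k+1]; nCk≡nC[n∸k])
open import Data.Nat.Properties
open import Algebra.Properties.CommutativeSemigroup +-commutativeSemigroup
  using (interchange; x∙yz≈y∙xz; x∙yz≈yx∙z; x∙yz≈xz∙y)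
open import Data.Nat.Tactic.RingSolver using (solve-∀)
open import Data.Sum using (inj₁; inj₂)
open import Function using (_∘_)
open import Relation.Binary.PropositionalEquality using (_≡_; refl; sym; trans; cong; cong₂)
open import Relation.Binary.PropositionalEquality.Properties using (module ≡-Reasoning)

sumTo-cong : ∀ t {f g : ℕ → ℕ} → (∀ j → j ≤ t → f j ≡ g j) → sumTo t f ≡ sumTo t g
sumTo-cong zero    f≗g = f≗g 0 z≤n
sumTo-cong (suc t) f≗g =
  cong₂ _+_ (sumTo-cong t (λ j j≤t → f≗g j (m≤n⇒m≤1+n j≤t))) (f≗g (suc t) ≤-refl)

sumTo-head : ∀ t (f : ℕ → ℕ) → sumTo (suc t) f ≡ f 0 + sumTo t (f ∘ suc)
sumTo-head zero    f = refl
sumTo-head (suc t) f = trans (cong (_+ f (suc (suc t))) (sumTo-head t f)) (+-assoc (f 0) _ _)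

sumTo-split : ∀ t {f g h : ℕ → ℕ} → (∀ j → f j ≡ g j + h j) →
              sumTo t f ≡ sumTo t g + sumTo t h
sumTo-split zero    f≗g+h = f≗g+h 0
sumTo-split (suc t) {f} {g} {h} f≗g+h =
  trans (cong₂ _+_ (sumTo-split t f≗g+h) (f≗g+h (suc t)))
        (interchange (sumTo t g) (sumTo t h) (g (suc t)) (h (suc t)))

sumTo-pascal : ∀ N t → sumTo (suc t) (suc N C_) ≡ sumTo (suc t) (N C_) + sumTo t (N C_)
sumTo-pascal N t = begin
  sumTo (suc t) (suc N C_)        ≡⟨ sumTo-head t (suc N C_) ⟩
  1 + sumTo t ((suc N C_) ∘ suc)  ≡⟨ cong (1 +_) (sumTo-split t pascal) ⟩
  1 + (S + S₊)                    ≡⟨ x∙yz≈xz∙y 1 S S₊ ⟩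
  (1 + S₊) + S                    ≡⟨ cong (_+ S) (sym (sumTo-head t (N C_))) ⟩
  sumTo (suc t) (N C_) + S        ∎
  where
  open ≡-Reasoning
  S S₊ : ℕ
  S  = sumTo t (N C_)
  S₊ = sumTo t ((N C_) ∘ suc)
  pascal : ∀ l → suc N C suc l ≡ N C l + N C suc l
  pascal l = sym (nCk+nC[k+1]≡[n+1]C[k+1] N l)

paths : ℕ → ℕ → ℕ
paths a b = (a + b) C a

paths-comm : ∀ a b → paths a b ≡ paths b a
paths-comm a b = begin
  (a + b) C a            ≡⟨ nCk≡nC[n∸k] (m≤m+n a b) ⟩
  (a + b) C (a + b ∸ a)  ≡⟨ cong ((a + b) C_) (m+n∸m≡n a b) ⟩
  (a + b) C b            ≡⟨ cong (_C b) (+-comm a b) ⟩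
  (b + a) C b            ∎
  where open ≡-Reasoning

paths-pascal : ∀ a b → paths (suc a) (suc b) ≡ paths a (suc b) + paths (suc a) b
paths-pascal a b = begin
  suc (a + suc b) C suc a                ≡⟨ sym (nCk+nC[k+1]≡[n+1]C[k+1] (a + suc b) a) ⟩
  (a + suc b) C a + (a + suc b) C suc a  ≡⟨ cong (λ m → (a + suc b) C a + m C suc a) (+-suc a b) ⟩
  (a + suc b) C a + suc (a + b) C suc a  ∎
  where open ≡-Reasoning

central : ℕ → ℕ → ℕ
central p j = paths j (p + j)

central-diagonal : ∀ j → central 0 (suc j) ≡ central 1 j + central 1 j
central-diagonal j = trans (paths-pascal j j) (cong (paths j (suc j) +_) (paths-comm (suc j) j))

central-pascal : ∀ p j → central (suc p) (suc j) ≡ central (suc (suc p)) j + central p (suc j)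
central-pascal p j =
  trans (paths-pascal j (p + suc j)) (cong (λ b → paths j (suc b) + central p (suc j)) (+-suc p j))

conv : (ℕ → ℕ) → (ℕ → ℕ) → ℕ → ℕ
conv f g t = sumTo t (λ j → f (t ∸ j) * g j)

conv-head : ∀ f g t → conv f g (suc t) ≡ f (suc t) * g 0 + conv f (g ∘ suc) t
conv-head f g t = sumTo-head t (λ j → f (suc t ∸ j) * g j)

conv-split : ∀ f {g h₁ h₂} t → (∀ j → g j ≡ h₁ j + h₂ j) →
             conv f g t ≡ conv f h₁ t + conv f h₂ t
conv-split f t g≗h₁+h₂ =
  sumTo-split t (λ j → trans (cong (f (t ∸ j) *_) (g≗h₁+h₂ j)) (*-distribˡ-+ (f (t ∸ j)) _ _))

p+[1+t+[d+1+t]]≡2+p+[t+[d+t]] : ∀ p t d → p + (suc t + (d + suc t)) ≡ suc (suc (p + (t + (d + t))))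
p+[1+t+[d+1+t]]≡2+p+[t+[d+t]] = solve-∀

conv-central : ∀ d p t → conv (central d) (central p) t ≡ sumTo t (suc (p + (t + (d + t))) C_)
conv-central d p zero = refl
conv-central d zero (suc t) = begin
  conv (central d) (central 0) (suc t)
    ≡⟨ conv-head (central d) (central 0) t ⟩
  a * 1 + conv (central d) (central 0 ∘ suc) t
    ≡⟨ cong₂ _+_ (*-identityʳ a) (conv-split (central d) t central-diagonal) ⟩
  a + (X + X)
    ≡⟨ cong (λ x → a + (x + x)) (trans (conv-central d 1 t) (cong S M≡)) ⟩
  a + (S M + S M)
    ≡⟨ x∙yz≈yx∙z a (S M) (S M) ⟩
  sumTo (suc t) (M C_) + S M
    ≡⟨ sym (sumTo-pascal M t) ⟩
  sumTo (suc t) (suc M C_) ∎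
  where
  open ≡-Reasoning
  M : ℕ
  M = suc t + (d + suc t)    -- so that a = central d (suc t) unfolds to M C suc t
  M≡ : suc (suc (t + (d + t))) ≡ M
  M≡ = sym (p+[1+t+[d+1+t]]≡2+p+[t+[d+t]] 0 t d)
  S : ℕ → ℕ
  S N = sumTo t (N C_)
  a X : ℕ
  a = central d (suc t)
  X = conv (central d) (central 1) t
conv-central d (suc p) (suc t) = begin
  conv (central d) (central (suc p)) (suc t)
    ≡⟨ conv-head (central d) (central (suc p)) t ⟩
  a + conv (central d) (central (suc p) ∘ suc) t
    ≡⟨ cong (a +_) (conv-split (central d) t (central-pascal p)) ⟩
  a + (X + Y)
    ≡⟨ x∙yz≈y∙xz a X Y ⟩
  X + (a + Y)
    ≡⟨ cong (X +_) (sym (conv-head (central d) (central p) t)) ⟩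
  X + conv (central d) (central p) (suc t)
    ≡⟨ cong₂ _+_ (trans (conv-central d (suc (suc p)) t) (cong S M≡)) (conv-central d p (suc t)) ⟩
  S M + sumTo (suc t) (M C_)
    ≡⟨ +-comm (S M) _ ⟩
  sumTo (suc t) (M C_) + S M
    ≡⟨ sym (sumTo-pascal M t) ⟩
  sumTo (suc t) (suc M C_) ∎
  where
  open ≡-Reasoning
  M : ℕ
  M = suc (p + (suc t + (d + suc t)))
  M≡ : suc (suc (suc p) + (t + (d + t))) ≡ M
  M≡ = cong suc (sym (p+[1+t+[d+1+t]]≡2+p+[t+[d+t]] p t d))
  S : ℕ → ℕ
  S N = sumTo t (N C_)
  a X Y : ℕ
  a = central d (suc t) * 1
  X = conv (central d) (central (suc (suc p))) t
  Y = conv (central d) (central p ∘ suc) t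

m∸o≡[m∸n]+[n∸o] : ∀ {m n o} → o ≤ n → n ≤ m → m ∸ o ≡ (m ∸ n) + (n ∸ o)
m∸o≡[m∸n]+[n∸o] {m} {n} {o} o≤n n≤m = begin
  m ∸ o              ≡⟨ cong (_∸ o) (sym (m∸n+n≡m n≤m)) ⟩
  (m ∸ n) + n ∸ o    ≡⟨ +-∸-assoc (m ∸ n) o≤n ⟩
  (m ∸ n) + (n ∸ o)  ∎
  where open ≡-Reasoning

m+n∸2o≡[m∸o]+[n∸o] : ∀ {m n o} → o ≤ m → o ≤ n → m + n ∸ 2 * o ≡ (m ∸ o) + (n ∸ o)
m+n∸2o≡[m∸o]+[n∸o] {m} {n} {o} o≤m o≤n = begin
  m + n ∸ 2 * o        ≡⟨ cong (m + n ∸_) (cong (o +_) (+-identityʳ o)) ⟩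
  m + n ∸ (o + o)      ≡⟨ sym (∸-+-assoc (m + n) o o) ⟩
  m + n ∸ o ∸ o        ≡⟨ cong (_∸ o) (+-∸-comm n o≤m) ⟩
  (m ∸ o) + n ∸ o      ≡⟨ +-∸-assoc (m ∸ o) o≤n ⟩
  (m ∸ o) + (n ∸ o)    ∎
  where open ≡-Reasoning

2m≤o⇒2n≤o⇒m+n≤o : ∀ {m n o} → 2 * m ≤ o → 2 * n ≤ o → m + n ≤ o
2m≤o⇒2n≤o⇒m+n≤o {m} {n} {o} 2m≤o 2n≤o = *-cancelˡ-≤ 2 (begin
  2 * (m + n)      ≡⟨ *-distribˡ-+ 2 m n ⟩
  2 * m + 2 * n    ≤⟨ +-mono-≤ 2m≤o 2n≤o ⟩
  o + o            ≡⟨ cong (o +_) (sym (+-identityʳ o)) ⟩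
  2 * o            ∎)
  where open ≤-Reasoning

C-as-paths : ∀ {a b j} → j ≤ a → j ≤ b → (a + b ∸ 2 * j) C (a ∸ j) ≡ paths (a ∸ j) (b ∸ j)
C-as-paths {a} {j = j} j≤a j≤b = cong (_C (a ∸ j)) (m+n∸2o≡[m∸o]+[n∸o] j≤a j≤b)

C-as-central : ∀ q j → (q + 2 * j) C (q + j) ≡ central q j
C-as-central q j = trans (cong (_C (q + j)) (q+2j≡q+j+j q j)) (paths-comm (q + j) j)
  where
  q+2j≡q+j+j : ∀ q j → q + 2 * j ≡ q + j + j
  q+2j≡q+j+j = solve-∀

paths-convolution : ∀ q {a b} → a ≤ b →
  sumTo a (λ j → paths (a ∸ j) (b ∸ j) * central q j) ≡
  sumTo a (suc (q + (a + b)) C_)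
paths-convolution q {a} {b} a≤b = begin
  sumTo a (λ j → paths (a ∸ j) (b ∸ j) * central q j)
    ≡⟨ sumTo-cong a (λ j j≤a →
         cong (λ c → paths (a ∸ j) c * central q j) (m∸o≡[m∸n]+[n∸o] j≤a a≤b)) ⟩
  conv (central (b ∸ a)) (central q) a
    ≡⟨ conv-central (b ∸ a) q a ⟩
  sumTo a (suc (q + (a + (b ∸ a + a))) C_)
    ≡⟨ cong (λ c → sumTo a (suc (q + (a + c)) C_)) (m∸n+n≡m a≤b) ⟩
  sumTo a (suc (q + (a + b)) C_) ∎
  where open ≡-Reasoning

paths-convolution-⊓ : ∀ q a b →
  sumTo (a ⊓ b) (λ j → paths (a ∸ j) (b ∸ j) * central q j) ≡
  sumTo (a ⊓ b) (suc (q + (a + b)) C_)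
paths-convolution-⊓ q a b with ≤-total a b
... | inj₁ a≤b rewrite m≤n⇒m⊓n≡m a≤b = paths-convolution q a≤b
... | inj₂ b≤a rewrite m≥n⇒m⊓n≡n b≤a | +-comm a b =
  trans (sumTo-cong b (λ j _ → cong (_* central q j) (paths-comm (a ∸ j) (b ∸ j))))
        (paths-convolution q b≤a)

theorem4p11 : (n k s : ℕ) → 2 * k + 1 ≤ n → 2 * s + 1 ≤ n →
    sumTo (s ⊓ k) (λ j → ((s + k ∸ 2 * j) C (s ∸ j)) * ((n ∸ 1 ∸ s ∸ k + 2 * j) C (n ∸ 1 ∸ s ∸ k + j)))
      ≡ sumTo (s ⊓ k) (λ l → n C l)
theorem4p11 zero    k s 2k+1≤n _ with () ← m+n≤o⇒n≤o (2 * k) 2k+1≤n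
theorem4p11 (suc m) k s 2k+1≤n 2s+1≤n = begin
  sumTo (s ⊓ k) (λ j → ((s + k ∸ 2 * j) C (s ∸ j)) * ((q + 2 * j) C (q + j)))
    ≡⟨ sumTo-cong (s ⊓ k) (λ j j≤s⊓k →
         cong₂ _*_ (C-as-paths (≤-trans j≤s⊓k (m⊓n≤m s k)) (≤-trans j≤s⊓k (m⊓n≤n s k)))
                   (C-as-central q j)) ⟩
  sumTo (s ⊓ k) (λ j → paths (s ∸ j) (k ∸ j) * central q j)
    ≡⟨ paths-convolution-⊓ q s k ⟩
  sumTo (s ⊓ k) (suc (q + (s + k)) C_)
    ≡⟨ cong (λ c → sumTo (s ⊓ k) (suc c C_)) q+[s+k]≡m ⟩
  sumTo (s ⊓ k) (suc m C_) ∎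
  where
  open ≡-Reasoning
  q : ℕ
  q = m ∸ s ∸ k
  s+k≤m : s + k ≤ m
  s+k≤m = 2m≤o⇒2n≤o⇒m+n≤o {s} {k} (m+n≤o⇒m≤o∸n (2 * s) 2s+1≤n) (m+n≤o⇒m≤o∸n (2 * k) 2k+1≤n)
  q+[s+k]≡m : q + (s + k) ≡ m
  q+[s+k]≡m = trans (cong (_+ (s + k)) (∸-+-assoc m s k)) (m∸n+n≡m s+k≤m)
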